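{- Let $A$ be a $\delta_{\mathcal P}$-ring in which the primes of $\mathcal P$ are non-zero-divisors, and assume $A$ is $\delta_{\mathcal P}$-generated by a subring $A^0\subset A$. Let $\partial:A^0\to A^0$ be a derivation. Then for each $r\in\mathbb Z_{\ge0}^d$ there is at most one $r$-conjugate $\partial_r$ of $\partial$ on $A$. Moreover, if $\partial_r$ is an $r$-conjugate of $\partial$ and $n\in\mathbb Z_{\ge 0}^d$ with $r\not\le n$, then $\partial_r A^n=0$, where $A^n\subset A$ denotes the $A^0$-subalgebra generated by $\{\delta^s_{\mathcal P}a;\ a\in A^0,\ s\le n\}$.
   Context: Let $\mathcal P=\{p_1,\dots,p_d\}$ be a finite set of primes. Multi-indices: $\mathbb Z_{\ge 0}^d$ with the componentwise order, $\mathcal P^r=p_1^{r_1}\cdots p_d^{r_d}$, and $\delta_{rs}$ is the Kronecker symbol. For a prime $p$ let $C_p(X,Y)=(X^p+Y^p-(X+Y)^p)/p$; a $p$-derivation $\delta:A\to A$ is a map with $\delta(1)=0$, $\delta(x+y)=\delta x+\delta y+C_p(x,y)$, $\delta(xy)=x^p\delta y+y^p\delta x+p\,\delta x\,\delta y$; then $\phi(x)=x^p+p\delta x$ is a ring endomorphism. For distinct primes $p,q$ put $C_{p,q}(X_0,X_1,X_2)=\frac{C_q(X_0^p,pX_1)}{p}-\frac{C_p(X_0^q,qX_2)}{q}-\frac{q-q^p}{pq}X_2^p+\frac{p-p^q}{pq}X_1^q$. A $\delta_{\mathcal P}$-ring is a ring $A$ with $p_k$-derivations $\delta_{p_k}:A\to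 A$ ($k=1,\dots,d$) satisfying $\delta_{p_k}\delta_{p_l}a-\delta_{p_l}\delta_{p_k}a=C_{p_k,p_l}(a,\delta_{p_k}a,\delta_{p_l}a)$. Put $\delta^s_{\mathcal P}=\delta_{p_1}^{s_1}\circ\cdots\circ\delta_{p_d}^{s_d}$ and $\phi^s_{\mathcal P}=\phi_{p_1}^{s_1}\circ\cdots\circ\phi_{p_d}^{s_d}$. $A$ is $\delta_{\mathcal P}$-generated by a subring $A^0$ if $A$ is generated as an $A^0$-algebra by $\{\delta^s_{\mathcal P}a;\ a\in A^0,\ s\ge0\}$. For a derivation $\partial:A^0\to A^0$ and $r\in\mathbb Z^d_{\ge0}$, an $r$-conjugate of $\partial$ on $A$ is a derivation $\partial_r:A\to A$ such that $\partial_r\circ\phi^s_{\mathcal P}=\delta_{rs}\cdot\mathcal P^r\cdot\phi^s_{\mathcal P}\circ\partial$ as maps $A^0\to A$, for all $s\in\mathbb Z_{\ge0}^d$. -}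

module Defs where

open import Level using (Level; _⊔_)
open import Algebra.Bundles using (CommutativeRing)
open import Algebra.Morphism.Structures using (module RingMorphisms)
open import Data.Nat as ℕ using (ℕ; zero; suc; _∸_)
open import Data.Nat.Combinatorics using (_C_)
open import Data.Nat.Primality using (Prime)
open import Data.Nat.Properties using (_≟_)
open import Data.Fin using (Fin) renaming (zero to fzero; suc to fsuc)
open import Data.Fin.Properties using (all?)
open import Data.Bool using (if_then_else_)
open import Data.Product using (Σ; _×_; _,_)
open import Function using (_∘_; id)
open import Relation.Binary.PropositionalEquality using (_≡_; _≢_)
open import Relation.Nullary using (¬_; does)

MultiIndex : ℕ → Set
MultiIndex d = Fin d → ℕ

_≤ᵐ_ : ∀ {d} → MultiIndex d → MultiIndex d → Set
r ≤ᵐ s = ∀ k → r k ℕ.≤ s k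

prodFin : ∀ {d} → (Fin d → ℕ) → ℕ
prodFin {zero}  f = 1
prodFin {suc d} f = f fzero ℕ.* prodFin (f ∘ fsuc)

_^ᴾ_ : ∀ {d} → (Fin d → ℕ) → MultiIndex d → ℕ
p ^ᴾ r = prodFin (λ k → p k ℕ.^ r k)

compFin : ∀ {a} {X : Set a} {d} → (Fin d → X → X) → X → X
compFin {d = zero}  f = id
compFin {d = suc d} f = f fzero ∘ compFin (f ∘ fsuc)

iter : ∀ {a} {X : Set a} → ℕ → (X → X) → X → X
iter zero    g = id
iter (suc n) g = g ∘ iter n g

-- natural-number division (only ever used for exact divisions by
-- nonzero numbers below; the zero case is irrelevant)
_div_ : ℕ → ℕ → ℕ
m div zero    = 0
m div (suc n) = m ℕ./ suc n

record PrimeFamily (d : ℕ) : Set where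
  field
    p        : Fin d → ℕ
    prime    : ∀ k → Prime (p k)
    distinct : ∀ k l → p k ≡ p l → k ≡ l

module _ {c ℓ} (A : CommutativeRing c ℓ) where
  open CommutativeRing A

  fromℕ : ℕ → Carrier
  fromℕ zero    = 0#
  fromℕ (suc n) = 1# + fromℕ n

  _^'_ : Carrier → ℕ → Carrier
  x ^' zero  = 1#
  x ^' suc n = x * (x ^' n)

  sum1 : ℕ → (ℕ → Carrier) → Carrier
  sum1 zero    f = 0#
  sum1 (suc m) f = sum1 m f + f (suc m)

  -- C_p(X,Y) = (X^p + Y^p - (X+Y)^p)/p = - Σ_{i=1}^{p-1} (binom(p,i)/p) X^i Y^{p-i}
  Cp : ℕ → Carrier → Carrier → Carrier
  Cp p x y = - sum1 (p ∸ 1) (λ i → fromℕ ((p C i) div p) * ((x ^' i) * (y ^' (p ∸ i))))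

  -- C_{p,q}(X0,X1,X2) = C_q(X0^p, pX1)/p - C_p(X0^q, qX2)/q
  --                     - (q - q^p)/(pq) X2^p + (p - p^q)/(pq) X1^q
  -- written out as the integer polynomial it is:
  --   C_q(X0^p,pX1)/p = - Σ_{i=1}^{q-1} (binom(q,i)/q) p^{q-i-1} X0^{pi} X1^{q-i}
  --   C_p(X0^q,qX2)/q = - Σ_{i=1}^{p-1} (binom(p,i)/p) q^{p-i-1} X0^{qi} X2^{p-i}
  --   -(q - q^p)/(pq) = (q^p - q)/(pq),   (p - p^q)/(pq) = -(p^q - p)/(pq)
  Cpq : ℕ → ℕ → Carrier → Carrier → Carrier → Carrier
  Cpq p q x0 x1 x2 =
      (- sum1 (q ∸ 1) (λ i → fromℕ (((q C i) div q) ℕ.* (p ℕ.^ (q ∸ i ∸ 1)))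
                              * ((x0 ^' (p ℕ.* i)) * (x1 ^' (q ∸ i)))))
    + (sum1 (p ∸ 1) (λ i → fromℕ (((p C i) div p) ℕ.* (q ℕ.^ (p ∸ i ∸ 1)))
                              * ((x0 ^' (q ℕ.* i)) * (x2 ^' (p ∸ i)))))
    + (fromℕ (((q ℕ.^ p) ∸ q) div (p ℕ.* q)) * (x2 ^' p))
    + (- (fromℕ (((p ℕ.^ q) ∸ p) div (p ℕ.* q)) * (x1 ^' q)))

  record IsPDerivation (p : ℕ) (δ : Carrier → Carrier) : Set (c ⊔ ℓ) where
    field
      cong : ∀ {x y} → x ≈ y → δ x ≈ δ y
      δ-1  : δ 1# ≈ 0#
      δ-+  : ∀ x y → δ (x + y) ≈ (δ x + δ y) + Cp p x y
      δ-*  : ∀ x y → δ (x * y) ≈ ((x ^' p) * δ y + (y ^' p) * δ x) + (fromℕ p * δ x) * δ y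

  φ : ℕ → (Carrier → Carrier) → Carrier → Carrier
  φ p δ x = (x ^' p) + fromℕ p * δ x

  record IsDeltaPRing {d} (P : PrimeFamily d) (δ : Fin d → Carrier → Carrier) : Set (c ⊔ ℓ) where
    open PrimeFamily P
    field
      pderiv : ∀ k → IsPDerivation (p k) (δ k)
      comm   : ∀ k l → k ≢ l → ∀ a →
               δ k (δ l a) + - δ l (δ k a) ≈ Cpq (p k) (p l) a (δ k a) (δ l a)

  δᴾ : ∀ {d} → (Fin d → Carrier → Carrier) → MultiIndex d → Carrier → Carrier
  δᴾ δ s = compFin (λ k → iter (s k) (δ k))

  φᴾ : ∀ {d} → PrimeFamily d → (Fin d → Carrier → Carrier) → MultiIndex d → Carrier → Carrier
  φᴾ P δ s = compFin (λ k → iter (s k) (φ (PrimeFamily.p P k) (δ k)))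

  PrimesNonZeroDivisors : ∀ {d} → PrimeFamily d → Set (c ⊔ ℓ)
  PrimesNonZeroDivisors P = ∀ k x → fromℕ (PrimeFamily.p P k) * x ≈ 0# → x ≈ 0#

  record IsDerivation (D : Carrier → Carrier) : Set (c ⊔ ℓ) where
    field
      cong : ∀ {x y} → x ≈ y → D x ≈ D y
      D-+  : ∀ x y → D (x + y) ≈ D x + D y
      D-*  : ∀ x y → D (x * y) ≈ x * D y + y * D x

  kron : ∀ {d} → MultiIndex d → MultiIndex d → Carrier
  kron r s = if does (all? (λ k → r k ≟ s k)) then 1# else 0#

-- Notions relative to a subring A⁰ ⊂ A, given as an injective ring
-- homomorphism ι : A⁰ → A

module _ {c₀ ℓ₀ c ℓ} (A⁰ : CommutativeRing c₀ ℓ₀) (A : CommutativeRing c ℓ) where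
  private
    module A⁰ = CommutativeRing A⁰
  open CommutativeRing A

  IsSubringEmbedding : (A⁰.Carrier → Carrier) → Set (c₀ ⊔ ℓ₀ ⊔ ℓ)
  IsSubringEmbedding ι =
    RingMorphisms.IsRingMonomorphism (CommutativeRing.rawRing A⁰) (CommutativeRing.rawRing A) ι

  data InSubalg (ι : A⁰.Carrier → Carrier) (S : Carrier → Set (c₀ ⊔ ℓ))
       : Carrier → Set (c₀ ⊔ c ⊔ ℓ) where
    base  : ∀ a → InSubalg ι S (ι a)
    gen   : ∀ {x} → S x → InSubalg ι S x
    zero' : InSubalg ι S 0#
    one'  : InSubalg ι S 1#
    plus  : ∀ {x y} → InSubalg ι S x → InSubalg ι S y → InSubalg ι S (x + y)
    neg   : ∀ {x} → InSubalg ι S x → InSubalg ι S (- x)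
    times : ∀ {x y} → InSubalg ι S x → InSubalg ι S y → InSubalg ι S (x * y)
    resp  : ∀ {x y} → x ≈ y → InSubalg ι S x → InSubalg ι S y

  DeltaGenerated : ∀ {d} → (Fin d → Carrier → Carrier) → (A⁰.Carrier → Carrier) → Set (c₀ ⊔ c ⊔ ℓ)
  DeltaGenerated δ ι =
    ∀ x → InSubalg ι (λ y → Σ A⁰.Carrier λ a → Σ (MultiIndex _) λ s → y ≈ δᴾ A δ s (ι a)) x

  InAⁿ : ∀ {d} → (Fin d → Carrier → Carrier) → (A⁰.Carrier → Carrier) → MultiIndex d → Carrier → Set (c₀ ⊔ c ⊔ ℓ)
  InAⁿ δ ι n =
    InSubalg ι (λ y → Σ A⁰.Carrier λ a → Σ (MultiIndex _) λ s → s ≤ᵐ n × y ≈ δᴾ A δ s (ι a))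

  record IsConjugate {d} (P : PrimeFamily d) (δ : Fin d → Carrier → Carrier)
                     (ι : A⁰.Carrier → Carrier) (∂ : A⁰.Carrier → A⁰.Carrier)
                     (r : MultiIndex d) (D : Carrier → Carrier) : Set (c₀ ⊔ c ⊔ ℓ) where
    field
      derivation : IsDerivation A D
      conj       : ∀ (s : MultiIndex d) (a : A⁰.Carrier) →
                   D (φᴾ A P δ s (ι a))
                     ≈ kron A r s * (fromℕ A (PrimeFamily.p P ^ᴾ r) * φᴾ A P δ s (ι (∂ a)))

{-# OPTIONS --safe #-}
-- Let E be an additive map A → A whose kernel is a subring: E = D − D′ for uniqueness, E = D
-- for vanishing. Each φ_p is a ring endomorphism (additivity is the identity
-- (x + y)^p + p C_p(x, y) = x^p + y^p), so E ∘ φ_p is again such a map; and p δ_p z = φ_p z − z^p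
-- with p a non-zero-divisor, so E z = E (φ_p z) = 0 forces E (δ_p z) = 0. Inducting over the
-- exponents, E kills δ^s_𝒫 x as soon as it kills every φ^t_𝒫 x with t ≤ s. For conjugates D, D′
-- the maps D ∘ φ^t_𝒫 and D′ ∘ φ^t_𝒫 agree on A⁰, and D ∘ φ^t_𝒫 vanishes on A⁰ when t ≤ n and
-- r ≰ n (then t ≠ r). Hence the kernel contains the generators of A, respectively of A^n, and so
-- the subalgebra they generate.
module Submission where

open import Defs
open import Algebra.Bundles using (CommutativeRing)
open import Data.Fin using (Fin; toℕ) renaming (zero to fzero; suc to fsuc)
open import Data.Product using (Σ; _×_; _,_)
open import Relation.Nullary using (¬_; Dec; yes; no; does)

open import Level using (_⊔_)
open import Data.Nat as ℕ using (ℕ; zero; suc; _∸_; _!; _<_; _≤_; s≤s; z≤n)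
import Data.Nat.Properties as ℕ
open import Data.Nat.Combinatorics using (_C_; nCn≡1; nCk≡n!/k![n-k]!; k![n∸k]!∣n!)
open import Data.Nat.Divisibility using (_∣_; _∤_; ∣⇒≤; ∣1⇒≡1; m∣m*n)
open import Data.Nat.DivMod using (m/n*n≡m)
open import Data.Nat.Primality using (Prime; euclidsLemma; ¬prime[0]; ¬prime[1])
open import Data.Fin.Properties using (all?; suc-injective)
open import Data.Vec.Functional using (_∷_)
open import Data.Sum using (inj₁; inj₂)
open import Data.Empty using (⊥-elim)
open import Function using (_∘_)
open import Data.Bool using (if_then_else_)
open import Relation.Binary.PropositionalEquality as ≡ using (_≡_)

prime∤m! : ∀ {p} → Prime p → ∀ {m} → m < p → p ∤ m !
prime∤m! p-prime {zero}  _   p∣1 rewrite ∣1⇒≡1 p∣1 = ¬prime[1] p-prime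
prime∤m! p-prime {suc m} m<p p∣m! with euclidsLemma (suc m) (m !) p-prime p∣m!
... | inj₁ p∣1+m = ℕ.<⇒≱ m<p (∣⇒≤ p∣1+m)
... | inj₂ p∣m!′ = prime∤m! p-prime (ℕ.<-trans (ℕ.n<1+n m) m<p) p∣m!′

prime∣C : ∀ {p i} → Prime p → 0 < i → i < p → p ∣ p C i
prime∣C {p} {i} p-prime 0<i i<p
  with euclidsLemma (p C i) (i ! ℕ.* (p ∸ i) !) p-prime p∣C*i![p-i]!
  where
    instance _ = i ℕ.!* (p ∸ i) !≢0
    C*i![p-i]!≡p! : (p C i) ℕ.* (i ! ℕ.* (p ∸ i) !) ≡ p !
    C*i![p-i]!≡p! = ≡.trans (≡.cong (ℕ._* (i ! ℕ.* (p ∸ i) !)) (nCk≡n!/k![n-k]! (ℕ.<⇒≤ i<p)))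
                            (m/n*n≡m (k![n∸k]!∣n! (ℕ.<⇒≤ i<p)))
    n∣n! : ∀ {n} → 0 < n → n ∣ n !
    n∣n! {suc n} _ = m∣m*n (n !)
    p∣C*i![p-i]! : p ∣ (p C i) ℕ.* (i ! ℕ.* (p ∸ i) !)
    p∣C*i![p-i]! = ≡.subst (p ∣_) (≡.sym C*i![p-i]!≡p!) (n∣n! (ℕ.<-trans 0<i i<p))
... | inj₁ p∣C = p∣C
... | inj₂ p∣i![p-i]! with euclidsLemma (i !) ((p ∸ i) !) p-prime p∣i![p-i]!
...   | inj₁ p∣i! = ⊥-elim (prime∤m! p-prime i<p p∣i!)
...   | inj₂ p∣[p-i]! = ⊥-elim (prime∤m! p-prime (ℕ.∸-monoʳ-< 0<i (ℕ.<⇒≤ i<p)) p∣[p-i]!)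

tailᴾ : ∀ {d} → PrimeFamily (suc d) → PrimeFamily d
tailᴾ P = record
  { p        = p ∘ fsuc
  ; prime    = prime ∘ fsuc
  ; distinct = λ k l pₖ≡pₗ → suc-injective (distinct (fsuc k) (fsuc l) pₖ≡pₗ)
  }
  where open PrimeFamily P

module _ {c ℓ} (A : CommutativeRing c ℓ) where
  open CommutativeRing A
  open import Relation.Binary.Reasoning.Setoid setoid
  open import Algebra.Properties.Ring ring using (-‿distribʳ-*; x+x≈x⇒x≈0)
  open import Algebra.Properties.AbelianGroup +-abelianGroup using (⁻¹-∙-comm; x∙y⁻¹≈ε⇒x≈y; x≈y⇒x∙y⁻¹≈ε)
  open import Algebra.Properties.Semiring.Mult semiring
    using (×-congʳ; ×-assoc-*; ×1-homo-*) renaming (_×_ to _×ᵐ_)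
  open import Algebra.Properties.CommutativeSemiring.Exp commutativeSemiring
    using (^-congˡ; ^-distrib-*) renaming (_^_ to _^ᴹ_)
  open import Algebra.Properties.CommutativeSemiring.Binomial commutativeSemiring
    using (binomialExpansion) renaming (theorem to binomial-theorem)
  open import Algebra.Properties.Monoid.Sum +-monoid using (sum; sum-cong-≋)
  open import Algebra.Solver.Ring.NaturalCoefficients.Default commutativeSemiring

  private
    N : ℕ → Carrier
    N = fromℕ A

    infixr 8 _^_
    _^_ : Carrier → ℕ → Carrier
    _^_ = _^'_ A

  fromℕ≡×1# : ∀ n → N n ≡ n ×ᵐ 1#
  fromℕ≡×1# zero    = ≡.refl
  fromℕ≡×1# (suc n) = ≡.cong (1# +_) (fromℕ≡×1# n)

  fromℕ-homo-* : ∀ m n → N (m ℕ.* n) ≈ N m * N n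
  fromℕ-homo-* m n = begin
    N (m ℕ.* n)            ≡⟨ fromℕ≡×1# (m ℕ.* n) ⟩
    (m ℕ.* n) ×ᵐ 1#        ≈⟨ ×1-homo-* m n ⟩
    (m ×ᵐ 1#) * (n ×ᵐ 1#)  ≡⟨ ≡.cong₂ _*_ (fromℕ≡×1# m) (fromℕ≡×1# n) ⟨
    N m * N n              ∎

  ×≈fromℕ-* : ∀ n x → n ×ᵐ x ≈ N n * x
  ×≈fromℕ-* n x = begin
    n ×ᵐ x         ≈⟨ ×-congʳ n (*-identityˡ x) ⟨
    n ×ᵐ (1# * x)  ≈⟨ ×-assoc-* n 1# x ⟨
    (n ×ᵐ 1#) * x  ≡⟨ ≡.cong (_* x) (fromℕ≡×1# n) ⟨
    N n * x        ∎

  ^'≡^ : ∀ x n → x ^ n ≡ x ^ᴹ n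
  ^'≡^ x zero    = ≡.refl
  ^'≡^ x (suc n) = ≡.cong (x *_) (^'≡^ x n)

  ^'-congˡ : ∀ n {x y} → x ≈ y → x ^ n ≈ y ^ n
  ^'-congˡ n {x} {y} x≈y = begin
    x ^ n    ≡⟨ ^'≡^ x n ⟩
    x ^ᴹ n   ≈⟨ ^-congˡ n x≈y ⟩
    y ^ᴹ n   ≡⟨ ^'≡^ y n ⟨
    y ^ n    ∎

  ^'-distrib-* : ∀ x y n → (x * y) ^ n ≈ x ^ n * y ^ n
  ^'-distrib-* x y n = begin
    (x * y) ^ n       ≡⟨ ^'≡^ (x * y) n ⟩
    (x * y) ^ᴹ n      ≈⟨ ^-distrib-* x y n ⟩
    x ^ᴹ n * y ^ᴹ n   ≡⟨ ≡.cong₂ _*_ (^'≡^ x n) (^'≡^ y n) ⟨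
    x ^ n * y ^ n     ∎

  1^n≈1 : ∀ n → 1# ^ n ≈ 1#
  1^n≈1 zero    = refl
  1^n≈1 (suc n) = trans (*-identityˡ _) (1^n≈1 n)

  sum1-cong : ∀ n {f g : ℕ → Carrier} → (∀ i → 0 < i → i ≤ n → f i ≈ g i) → sum1 A n f ≈ sum1 A n g
  sum1-cong zero    f≈g = refl
  sum1-cong (suc n) f≈g =
    +-cong (sum1-cong n (λ i 0<i i≤n → f≈g i 0<i (ℕ.m≤n⇒m≤1+n i≤n))) (f≈g (suc n) (s≤s z≤n) ℕ.≤-refl)

  *-distribˡ-sum1 : ∀ n x f → x * sum1 A n f ≈ sum1 A n (λ i → x * f i)
  *-distribˡ-sum1 zero    x f = zeroʳ x
  *-distribˡ-sum1 (suc n) x f = trans (distribˡ x _ _) (+-congʳ (*-distribˡ-sum1 n x f))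

  sum1-unfoldˡ : ∀ n f → sum1 A (suc n) f ≈ f 1 + sum1 A n (f ∘ suc)
  sum1-unfoldˡ zero    f = trans (+-identityˡ _) (sym (+-identityʳ _))
  sum1-unfoldˡ (suc n) f = trans (+-congʳ (sum1-unfoldˡ n f)) (+-assoc _ _ _)

  sum≈sum1 : ∀ n (f : ℕ → Carrier) → sum {suc n} (f ∘ toℕ) ≈ f 0 + sum1 A n f
  sum≈sum1 zero    f = refl
  sum≈sum1 (suc n) f = +-congˡ (trans (sum≈sum1 n (f ∘ suc)) (sym (sum1-unfoldˡ n f)))

  binomial-sum1 : ∀ q x y → let p = suc q in
    (x + y) ^ p ≈ (y ^ p + sum1 A q (λ i → N (p C i) * (x ^ i * y ^ (p ∸ i)))) + x ^ p
  binomial-sum1 q x y = begin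
    (x + y) ^ p                        ≡⟨ ^'≡^ (x + y) p ⟩
    (x + y) ^ᴹ p                       ≈⟨ binomial-theorem p x y ⟩
    binomialExpansion x y p            ≈⟨ sum-cong-≋ {suc p} (term≈ ∘ toℕ) ⟩
    sum {suc p} (term ∘ toℕ)           ≈⟨ sum≈sum1 p term ⟩
    term 0 + (sum1 A q term + term p)  ≈⟨ +-cong first (+-congˡ last) ⟩
    y ^ p + (sum1 A q term + x ^ p)    ≈⟨ +-assoc _ _ _ ⟨
    (y ^ p + sum1 A q term) + x ^ p    ∎
    where
      p = suc q
      term : ℕ → Carrier
      term i = N (p C i) * (x ^ i * y ^ (p ∸ i))
      term≈ : ∀ i → (p C i) ×ᵐ (x ^ᴹ i * y ^ᴹ (p ∸ i)) ≈ term i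
      term≈ i = trans (×≈fromℕ-* (p C i) _)
                      (*-congˡ (sym (reflexive (≡.cong₂ _*_ (^'≡^ x i) (^'≡^ y (p ∸ i))))))
      first : term 0 ≈ y ^ p
      first = solve 1 (λ a → (con 1 :+ con 0) :* (con 1 :* a) := a) refl (y ^ p)
      last : term p ≈ x ^ p
      last = begin
        N (p C p) * (x ^ p * y ^ (p ∸ p))
          ≡⟨ ≡.cong₂ (λ m n → N m * (x ^ p * y ^ n)) (nCn≡1 p) (ℕ.n∸n≡0 p) ⟩
        (1# + 0#) * (x ^ p * 1#)
          ≈⟨ solve 1 (λ a → (con 1 :+ con 0) :* (a :* con 1) := a) refl (x ^ p) ⟩
        x ^ p
          ∎

  [x+y]^p+p*Cp≈x^p+y^p : ∀ {p} → Prime p → ∀ x y → (x + y) ^ p + N p * Cp A p x y ≈ x ^ p + y ^ p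
  [x+y]^p+p*Cp≈x^p+y^p {zero} p-prime = ⊥-elim (¬prime[0] p-prime)
  [x+y]^p+p*Cp≈x^p+y^p {p@(suc q)} p-prime x y = begin
    (x + y) ^ p + N p * (- sum1 A q term/p)
      ≈⟨ +-cong (binomial-sum1 q x y) (sym (-‿distribʳ-* (N p) _)) ⟩
    ((y ^ p + H) + x ^ p) + - (N p * sum1 A q term/p)
      ≈⟨ +-congˡ (-‿cong (trans (*-distribˡ-sum1 q (N p) term/p) (sum1-cong q p*term/p≈term))) ⟩
    ((y ^ p + H) + x ^ p) + - H
      ≈⟨ solve 4 (λ u v h h′ → ((v :+ h) :+ u) :+ h′ := (u :+ v) :+ (h :+ h′))
                 refl (x ^ p) (y ^ p) H (- H) ⟩
    (x ^ p + y ^ p) + (H + - H)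
      ≈⟨ trans (+-congˡ (-‿inverseʳ H)) (+-identityʳ _) ⟩
    x ^ p + y ^ p
      ∎
    where
      monomial : ℕ → Carrier
      monomial i = x ^ i * y ^ (p ∸ i)
      term/p : ℕ → Carrier
      term/p i = N ((p C i) div p) * monomial i
      H : Carrier
      H = sum1 A q (λ i → N (p C i) * monomial i)
      p*term/p≈term : ∀ i → 0 < i → i ≤ q → N p * term/p i ≈ N (p C i) * monomial i
      p*term/p≈term i 0<i i≤q = begin
        N p * (N ((p C i) ℕ./ p) * monomial i)
          ≈⟨ solve 3 (λ a b m → a :* (b :* m) := (b :* a) :* m) refl (N p) _ (monomial i) ⟩
        (N ((p C i) ℕ./ p) * N p) * monomial i
          ≈⟨ *-congʳ (fromℕ-homo-* ((p C i) ℕ./ p) p) ⟨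
        N ((p C i) ℕ./ p ℕ.* p) * monomial i
          ≡⟨ ≡.cong (λ n → N n * monomial i) (m/n*n≡m (prime∣C p-prime 0<i (s≤s i≤q))) ⟩
        N (p C i) * monomial i
          ∎

  record HasSubringKernel (E : Carrier → Carrier) : Set (c ⊔ ℓ) where
    field
      cong     : ∀ {x y} → x ≈ y → E x ≈ E y
      +-homo   : ∀ x y → E (x + y) ≈ E x + E y
      kernel-1 : E 1# ≈ 0#
      kernel-* : ∀ {x y} → E x ≈ 0# → E y ≈ 0# → E (x * y) ≈ 0#

    0#-homo : E 0# ≈ 0#
    0#-homo = x+x≈x⇒x≈0 (E 0#) (trans (sym (+-homo 0# 0#)) (cong (+-identityʳ 0#)))

    kernel-+ : ∀ {x y} → E x ≈ 0# → E y ≈ 0# → E (x + y) ≈ 0#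
    kernel-+ Ex≈0 Ey≈0 = trans (+-homo _ _) (trans (+-cong Ex≈0 Ey≈0) (+-identityʳ 0#))

    kernel-‿ : ∀ {x} → E x ≈ 0# → E (- x) ≈ 0#
    kernel-‿ {x} Ex≈0 = begin
      E (- x)        ≈⟨ +-identityʳ _ ⟨
      E (- x) + 0#   ≈⟨ +-congˡ Ex≈0 ⟨
      E (- x) + E x  ≈⟨ +-homo (- x) x ⟨
      E (- x + x)    ≈⟨ cong (-‿inverseˡ x) ⟩
      E 0#           ≈⟨ 0#-homo ⟩
      0#             ∎

    kernel-^ : ∀ n {x} → E x ≈ 0# → E (x ^ n) ≈ 0#
    kernel-^ zero    _    = kernel-1
    kernel-^ (suc n) Ex≈0 = kernel-* Ex≈0 (kernel-^ n Ex≈0)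

    fromℕ-*-homo : ∀ n x → E (N n * x) ≈ N n * E x
    fromℕ-*-homo zero    x = trans (cong (zeroˡ x)) (trans 0#-homo (sym (zeroˡ _)))
    fromℕ-*-homo (suc n) x = begin
      E ((1# + N n) * x) ≈⟨ cong (solve 2 (λ a m → (con 1 :+ m) :* a := a :+ m :* a) refl x (N n)) ⟩
      E (x + N n * x)    ≈⟨ +-homo _ _ ⟩
      E x + E (N n * x)  ≈⟨ +-congˡ (fromℕ-*-homo n x) ⟩
      E x + N n * E x    ≈⟨ solve 2 (λ e m → e :+ m :* e := (con 1 :+ m) :* e) refl (E x) (N n) ⟩
      (1# + N n) * E x   ∎

  subalgebra⊆kernel : ∀ {c₀ ℓ₀} {A⁰ : CommutativeRing c₀ ℓ₀} {ι S E} → HasSubringKernel E →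
                      (∀ a → E (ι a) ≈ 0#) → (∀ {y} → S y → E y ≈ 0#) →
                      ∀ {x} → InSubalg A⁰ A ι S x → E x ≈ 0#
  subalgebra⊆kernel {E = E} E-kernel ι⊆ker S⊆ker = go
    where
      open HasSubringKernel E-kernel
      go : ∀ {x} → InSubalg _ A _ _ x → E x ≈ 0#
      go (base a)      = ι⊆ker a
      go (gen y∈S)     = S⊆ker y∈S
      go zero'         = 0#-homo
      go one'          = kernel-1
      go (plus x∈ y∈)  = kernel-+ (go x∈) (go y∈)
      go (neg x∈)      = kernel-‿ (go x∈)
      go (times x∈ y∈) = kernel-* (go x∈) (go y∈)
      go (resp x≈y x∈) = trans (cong (sym x≈y)) (go x∈)

  derivation-1 : ∀ {D} → IsDerivation A D → D 1# ≈ 0#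
  derivation-1 {D} D-derivation = x+x≈x⇒x≈0 (D 1#) (begin
    D 1# + D 1#            ≈⟨ +-cong (*-identityˡ _) (*-identityˡ _) ⟨
    1# * D 1# + 1# * D 1#  ≈⟨ D-* 1# 1# ⟨
    D (1# * 1#)            ≈⟨ cong (*-identityˡ 1#) ⟩
    D 1#                   ∎)
    where open IsDerivation D-derivation

  derivation⇒hasSubringKernel : ∀ {D} → IsDerivation A D → HasSubringKernel D
  derivation⇒hasSubringKernel {D} D-derivation = record
    { cong     = cong
    ; +-homo   = D-+
    ; kernel-1 = derivation-1 D-derivation
    ; kernel-* = λ {x} {y} Dx≈0 Dy≈0 → begin
        D (x * y)          ≈⟨ D-* x y ⟩
        x * D y + y * D x  ≈⟨ +-cong (*-congˡ Dy≈0) (*-congˡ Dx≈0) ⟩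
        x * 0# + y * 0#    ≈⟨ solve 2 (λ a b → a :* con 0 :+ b :* con 0 := con 0) refl x y ⟩
        0#                 ∎
    }
    where open IsDerivation D-derivation

  derivation-difference⇒hasSubringKernel : ∀ {D D′} → IsDerivation A D → IsDerivation A D′ →
                                           HasSubringKernel (λ x → D x + - D′ x)
  derivation-difference⇒hasSubringKernel {D} {D′} D-derivation D′-derivation = record
    { cong     = λ x≈y → +-cong (cong x≈y) (-‿cong (cong′ x≈y))
    ; +-homo   = λ x y → begin
        D (x + y) + - D′ (x + y)
          ≈⟨ +-cong (D-+ x y) (-‿cong (D-+′ x y)) ⟩
        (D x + D y) + - (D′ x + D′ y)
          ≈⟨ +-congˡ (⁻¹-∙-comm (D′ x) (D′ y)) ⟨
        (D x + D y) + (- D′ x + - D′ y)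
          ≈⟨ solve 4 (λ a b a′ b′ → (a :+ b) :+ (a′ :+ b′) := (a :+ a′) :+ (b :+ b′))
                     refl (D x) (D y) (- D′ x) (- D′ y) ⟩
        (D x + - D′ x) + (D y + - D′ y)
          ∎
    ; kernel-1 = trans (+-cong (derivation-1 D-derivation) (-‿cong (derivation-1 D′-derivation)))
                       (-‿inverseʳ 0#)
    ; kernel-* = λ {x} {y} Ex≈0 Ey≈0 → x≈y⇒x∙y⁻¹≈ε (begin
        D (x * y)            ≈⟨ D-* x y ⟩
        x * D y + y * D x    ≈⟨ +-cong (*-congˡ (x∙y⁻¹≈ε⇒x≈y _ _ Ey≈0)) (*-congˡ (x∙y⁻¹≈ε⇒x≈y _ _ Ex≈0)) ⟩
        x * D′ y + y * D′ x  ≈⟨ D-*′ x y ⟨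
        D′ (x * y)           ∎)
    }
    where
      open IsDerivation D-derivation
      open IsDerivation D′-derivation renaming (cong to cong′; D-+ to D-+′; D-* to D-*′)

  module _ {p} (p-prime : Prime p) {δ} (δ-isPDerivation : IsPDerivation A p δ) where
    open IsPDerivation δ-isPDerivation renaming (cong to δ-cong)

    private
      φₚ : Carrier → Carrier
      φₚ = φ A p δ

    φ-cong : ∀ {x y} → x ≈ y → φₚ x ≈ φₚ y
    φ-cong x≈y = +-cong (^'-congˡ p x≈y) (*-congˡ (δ-cong x≈y))

    φ-homo-1 : φₚ 1# ≈ 1#
    φ-homo-1 = trans (+-cong (1^n≈1 p) (trans (*-congˡ δ-1) (zeroʳ _))) (+-identityʳ 1#)

    φ-homo-+ : ∀ x y → φₚ (x + y) ≈ φₚ x + φₚ y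
    φ-homo-+ x y = begin
      (x + y) ^ p + N p * δ (x + y)
        ≈⟨ +-congˡ (*-congˡ (δ-+ x y)) ⟩
      (x + y) ^ p + N p * ((δ x + δ y) + Cp A p x y)
        ≈⟨ solve 5 (λ s n a b c → s :+ n :* ((a :+ b) :+ c) := (s :+ n :* c) :+ (n :* a :+ n :* b))
                   refl ((x + y) ^ p) (N p) (δ x) (δ y) (Cp A p x y) ⟩
      ((x + y) ^ p + N p * Cp A p x y) + (N p * δ x + N p * δ y)
        ≈⟨ +-congʳ ([x+y]^p+p*Cp≈x^p+y^p p-prime x y) ⟩
      (x ^ p + y ^ p) + (N p * δ x + N p * δ y)
        ≈⟨ solve 4 (λ u v a b → (u :+ v) :+ (a :+ b) := (u :+ a) :+ (v :+ b))
                   refl (x ^ p) (y ^ p) (N p * δ x) (N p * δ y) ⟩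
      φₚ x + φₚ y
        ∎

    φ-homo-* : ∀ x y → φₚ (x * y) ≈ φₚ x * φₚ y
    φ-homo-* x y = begin
      (x * y) ^ p + N p * δ (x * y)
        ≈⟨ +-cong (^'-distrib-* x y p) (*-congˡ (δ-* x y)) ⟩
      x ^ p * y ^ p + N p * ((x ^ p * δ y + y ^ p * δ x) + (N p * δ x) * δ y)
        ≈⟨ solve 5 (λ u v n a b → u :* v :+ n :* ((u :* b :+ v :* a) :+ (n :* a) :* b)
                                  := (u :+ n :* a) :* (v :+ n :* b))
                   refl (x ^ p) (y ^ p) (N p) (δ x) (δ y) ⟩
      φₚ x * φₚ y
        ∎

    ∘φ-hasSubringKernel : ∀ {E} → HasSubringKernel E → HasSubringKernel (E ∘ φₚ)
    ∘φ-hasSubringKernel E-kernel = record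
      { cong     = cong ∘ φ-cong
      ; +-homo   = λ x y → trans (cong (φ-homo-+ x y)) (+-homo _ _)
      ; kernel-1 = trans (cong φ-homo-1) kernel-1
      ; kernel-* = λ {x} {y} Eφₚx≈0 Eφₚy≈0 → trans (cong (φ-homo-* x y)) (kernel-* Eφₚx≈0 Eφₚy≈0)
      }
      where open HasSubringKernel E-kernel

    ∘iterφ-hasSubringKernel : ∀ j {E} → HasSubringKernel E → HasSubringKernel (E ∘ iter j φₚ)
    ∘iterφ-hasSubringKernel zero    E-kernel = E-kernel
    ∘iterφ-hasSubringKernel (suc j) E-kernel = ∘iterφ-hasSubringKernel j (∘φ-hasSubringKernel E-kernel)

    module _ (p-nonZeroDivisor : ∀ x → N p * x ≈ 0# → x ≈ 0#) where

      kernel-δ : ∀ {E} → HasSubringKernel E → ∀ {z} → E z ≈ 0# → E (φₚ z) ≈ 0# → E (δ z) ≈ 0#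
      kernel-δ {E} E-kernel {z} Ez≈0 Eφₚz≈0 = p-nonZeroDivisor (E (δ z)) (begin
        N p * E (δ z)              ≈⟨ fromℕ-*-homo p (δ z) ⟨
        E (N p * δ z)              ≈⟨ +-identityˡ _ ⟨
        0# + E (N p * δ z)         ≈⟨ +-congʳ (kernel-^ p Ez≈0) ⟨
        E (z ^ p) + E (N p * δ z)  ≈⟨ +-homo _ _ ⟨
        E (φₚ z)                   ≈⟨ Eφₚz≈0 ⟩
        0#                         ∎)
        where open HasSubringKernel E-kernel

      kernel-iterδ : ∀ m {E} → HasSubringKernel E → ∀ {z} →
                     (∀ j → j ≤ m → E (iter j φₚ z) ≈ 0#) → E (iter m δ z) ≈ 0#
      kernel-iterδ zero    E-kernel φₚʲz∈ker = φₚʲz∈ker 0 z≤n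
      kernel-iterδ (suc m) E-kernel φₚʲz∈ker = kernel-δ E-kernel
        (kernel-iterδ m E-kernel (λ j j≤m → φₚʲz∈ker j (ℕ.m≤n⇒m≤1+n j≤m)))
        (kernel-iterδ m (∘φ-hasSubringKernel E-kernel) (λ j j≤m → φₚʲz∈ker (suc j) (s≤s j≤m)))

  δᴾ-zero : ∀ {d} (δ : Fin d → Carrier → Carrier) x → δᴾ A δ (λ _ → 0) x ≡ x
  δᴾ-zero {zero}  δ x = ≡.refl
  δᴾ-zero {suc d} δ x = δᴾ-zero (δ ∘ fsuc) x

  kernel-δᴾ : ∀ {d} (P : PrimeFamily d) {δ} → (∀ k → IsPDerivation A (PrimeFamily.p P k) (δ k)) →
              PrimesNonZeroDivisors A P → ∀ {E} → HasSubringKernel E → ∀ s x →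
              (∀ t → t ≤ᵐ s → E (φᴾ A P δ t x) ≈ 0#) → E (δᴾ A δ s x) ≈ 0#
  kernel-δᴾ {zero}  P δ-pDerivation p-nonZeroDivisor E-kernel s x φᵗx∈ker = φᵗx∈ker s (λ ())
  kernel-δᴾ {suc d} P {δ} δ-pDerivation p-nonZeroDivisor E-kernel s x φᵗx∈ker =
    kernel-iterδ p₀-prime δ₀-pDerivation (p-nonZeroDivisor fzero) (s fzero) E-kernel λ j j≤s₀ →
      kernel-δᴾ (tailᴾ P) (δ-pDerivation ∘ fsuc) (p-nonZeroDivisor ∘ fsuc)
        (∘iterφ-hasSubringKernel p₀-prime δ₀-pDerivation j E-kernel) (s ∘ fsuc) x
        λ t t≤s′ → φᵗx∈ker (j ∷ t) λ { fzero → j≤s₀ ; (fsuc k) → t≤s′ k }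
    where
      p₀-prime : Prime (PrimeFamily.p P fzero)
      p₀-prime = PrimeFamily.prime P fzero
      δ₀-pDerivation : IsPDerivation A (PrimeFamily.p P fzero) (δ fzero)
      δ₀-pDerivation = δ-pDerivation fzero

  kron-≢ : ∀ {d} {r s : MultiIndex d} → ¬ (∀ k → r k ≡ s k) → kron A r s ≈ 0#
  kron-≢ {r = r} {s} r≢s = if-no (all? (λ k → r k ℕ.≟ s k))
    where
      if-no : (r≟s : Dec (∀ k → r k ≡ s k)) → (if does r≟s then 1# else 0#) ≈ 0#
      if-no (yes r≡s) = ⊥-elim (r≢s r≡s)
      if-no (no _)    = refl

module _ {c₀ ℓ₀ c ℓ} {d} {P : PrimeFamily d}
         {A⁰ : CommutativeRing c₀ ℓ₀} {A : CommutativeRing c ℓ}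
         {δ : Fin d → CommutativeRing.Carrier A → CommutativeRing.Carrier A}
         {ι : CommutativeRing.Carrier A⁰ → CommutativeRing.Carrier A}
         {∂ : CommutativeRing.Carrier A⁰ → CommutativeRing.Carrier A⁰}
         (δ-pDerivation : ∀ k → IsPDerivation A (PrimeFamily.p P k) (δ k))
         (p-nonZeroDivisor : PrimesNonZeroDivisors A P)
         where
  open CommutativeRing A
  open import Algebra.Properties.AbelianGroup +-abelianGroup using (x∙y⁻¹≈ε⇒x≈y; x≈y⇒x∙y⁻¹≈ε)
  private
    module A⁰ = CommutativeRing A⁰

  conjugate-unique : ∀ {r D D′} → DeltaGenerated A⁰ A δ ι →
                     IsConjugate A⁰ A P δ ι ∂ r D → IsConjugate A⁰ A P δ ι ∂ r D′ →
                     ∀ x → D x ≈ D′ x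
  conjugate-unique {D = D} {D′ = D′} generated D-conjugate D′-conjugate x =
    x∙y⁻¹≈ε⇒x≈y _ _ (subalgebra⊆kernel A E-kernel ι⊆ker generators⊆ker (generated x))
    where
      module D  = IsConjugate D-conjugate
      module D′ = IsConjugate D′-conjugate
      E : Carrier → Carrier
      E y = D y + - D′ y
      E-kernel : HasSubringKernel A E
      E-kernel = derivation-difference⇒hasSubringKernel A D.derivation D′.derivation
      δˢι⊆ker : ∀ s a → E (δᴾ A δ s (ι a)) ≈ 0#
      δˢι⊆ker s a = kernel-δᴾ A P δ-pDerivation p-nonZeroDivisor E-kernel s (ι a)
                      λ t _ → x≈y⇒x∙y⁻¹≈ε (trans (D.conj t a) (sym (D′.conj t a)))
      ι⊆ker : ∀ a → E (ι a) ≈ 0#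
      ι⊆ker a = ≡.subst (λ y → E y ≈ 0#) (δᴾ-zero A δ (ι a)) (δˢι⊆ker (λ _ → 0) a)
      generators⊆ker : ∀ {y} → Σ A⁰.Carrier (λ a → Σ (MultiIndex d) λ s → y ≈ δᴾ A δ s (ι a)) →
                       E y ≈ 0#
      generators⊆ker (a , s , y≈δˢιa) =
        trans (HasSubringKernel.cong E-kernel y≈δˢιa) (δˢι⊆ker s a)

  conjugate-vanishes : ∀ {r D} → IsConjugate A⁰ A P δ ι ∂ r D →
                       ∀ {n} → ¬ (r ≤ᵐ n) → ∀ {x} → InAⁿ A⁰ A δ ι n x → D x ≈ 0#
  conjugate-vanishes {r} {D} D-conjugate {n} r≰n =
    subalgebra⊆kernel A D-kernel ι⊆ker generators⊆ker
    where
      open IsConjugate D-conjugate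
      D-kernel : HasSubringKernel A D
      D-kernel = derivation⇒hasSubringKernel A derivation
      r≢ : ∀ {t} → t ≤ᵐ n → ¬ (∀ k → r k ≡ t k)
      r≢ t≤n r≡t = r≰n λ k → ℕ.≤-trans (ℕ.≤-reflexive (r≡t k)) (t≤n k)
      δˢι⊆ker : ∀ {s} a → s ≤ᵐ n → D (δᴾ A δ s (ι a)) ≈ 0#
      δˢι⊆ker {s} a s≤n = kernel-δᴾ A P δ-pDerivation p-nonZeroDivisor D-kernel s (ι a) λ t t≤s →
        trans (conj t a) (trans (*-congʳ (kron-≢ A (r≢ λ k → ℕ.≤-trans (t≤s k) (s≤n k)))) (zeroˡ _))
      ι⊆ker : ∀ a → D (ι a) ≈ 0#
      ι⊆ker a = ≡.subst (λ y → D y ≈ 0#) (δᴾ-zero A δ (ι a)) (δˢι⊆ker a (λ _ → z≤n))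
      generators⊆ker : ∀ {y} → Σ A⁰.Carrier (λ a → Σ (MultiIndex d) λ s → s ≤ᵐ n × y ≈ δᴾ A δ s (ι a)) →
                       D y ≈ 0#
      generators⊆ker (a , s , s≤n , y≈δˢιa) =
        trans (HasSubringKernel.cong D-kernel y≈δˢιa) (δˢι⊆ker a s≤n)

proposition4p1 :
    ∀ {c₀ ℓ₀ c ℓ} {d} (P : PrimeFamily d)
      (A⁰ : CommutativeRing c₀ ℓ₀) (A : CommutativeRing c ℓ)
      (δ : Fin d → CommutativeRing.Carrier A → CommutativeRing.Carrier A)
      (ι : CommutativeRing.Carrier A⁰ → CommutativeRing.Carrier A)
      (∂ : CommutativeRing.Carrier A⁰ → CommutativeRing.Carrier A⁰) →
    IsDeltaPRing A P δ →
    PrimesNonZeroDivisors A P →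
    IsSubringEmbedding A⁰ A ι →
    DeltaGenerated A⁰ A δ ι →
    IsDerivation A⁰ ∂ →
    (∀ (r : MultiIndex d) (D D′ : CommutativeRing.Carrier A → CommutativeRing.Carrier A) →
       IsConjugate A⁰ A P δ ι ∂ r D → IsConjugate A⁰ A P δ ι ∂ r D′ →
       ∀ x → CommutativeRing._≈_ A (D x) (D′ x))
    ×
    (∀ (r : MultiIndex d) (D : CommutativeRing.Carrier A → CommutativeRing.Carrier A) →
       IsConjugate A⁰ A P δ ι ∂ r D →
       ∀ (n : MultiIndex d) → ¬ (r ≤ᵐ n) →
       ∀ x → InAⁿ A⁰ A δ ι n x → CommutativeRing._≈_ A (D x) (CommutativeRing.0# A))
proposition4p1 P A⁰ A δ ι ∂ δ-ring p-nonZeroDivisor _ generated _ =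
    (λ r D D′ → conjugate-unique pderiv p-nonZeroDivisor generated)
  , (λ r D D-conjugate n r≰n x → conjugate-vanishes pderiv p-nonZeroDivisor D-conjugate r≰n)
  where open IsDeltaPRing δ-ring
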